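{- Let $\Pi$ be an {\tt STI} derivation with conclusion $\Gamma \vdash M:\sigma$. Then: (i) $\mathrm{rk}(\Pi) \leq |M| \leq |\Pi|$; (ii) $W(\Pi, r) \leq r^{d(\Pi)} \cdot W(\Pi, 1)$ for every $r \geq 1$; (iii) $W(\Pi, 1) = |M|$.
   Context: System {\tt STI}: $\lambda$-terms $M ::= x \mid MM \mid \lambda x.M$. Types: linear types $A ::= a \mid \sigma \to A$ and intersection types $\sigma ::= A \mid \sigma_1\wedge\dots\wedge\sigma_n$ ($n>1$), where $\wedge$ is commutative but neither idempotent nor associative. A context is a finite set of assumptions $x:\sigma$ with distinct variables; $\Gamma,\Delta$ is union of contexts with disjoint domains (written $\Gamma \# \Delta$), and $\Gamma\wedge\Delta$ intersects the types of shared variables. Rules: (Ax) $x:A \vdash x:A$; (w) from $\Gamma\vdash M:\sigma$ and $x\notin dom(\Gamma)$ infer $\Gamma, x:A \vdash M:\sigma$; ($\to$I) from $\Gamma, x:\sigma \vdash M:A$ infer $\Gamma\vdash \lambda x.M:\sigma\to A$; ($\to$E) from $\Gamma\vdash M:\sigma\to A$, $\Delta\vdash N:\sigma$, $\Gamma\#\Delta$ infer $\Gamma,\Delta\vdash MN:A$; ($\wedge_n$) from $\Gamma_i\vdash M:\sigma_i$ ($1\le i\le n$, $n>1$) infer $\bigwedge_i\Gamma_i \vdash M:\sigma_1\wedge\dots\wedge\sigma_n$; (m) from $\Gamma, x_1:\sigma_1,\dots,x_n:\sigma_n\vdash M:\tau$ infer $\Gamma, x:\sigma_1\wedge\dots\wedge\sigma_n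 \vdash M[x/x_1,\dots,x/x_n]:\tau$. Measures: $|\Pi|$ is the number of rule applications in $\Pi$ (axiom has size 1, a rule with premises $\Pi_i$ has size $\sum|\Pi_i|+1$). Term size: $|x|=1$, $|\lambda x.M|=|M|+1$, $|MN|=|M|+|N|+1$. The rank of an (m) rule is the number of the variables $x_i$ that are free in $M$; $\mathrm{rk}(\Pi)$ is the maximum of 1 and the maximal rank of an (m) rule in $\Pi$. The degree $d(\Pi)$ is the maximal number of ($\wedge_n$) rules along a path from the conclusion to an axiom. The weight $W(\Pi,r)$: 1 for (Ax); $W(\Sigma,r)+1$ for ($\to$I) with premise $\Sigma$; $W(\Sigma_1,r)+W(\Sigma_2,r)+1$ for ($\to$E); $r\cdot\max_i W(\Sigma_i,r)$ for ($\wedge_n$) with premises $\Sigma_1,\dots,\Sigma_n$; $W(\Sigma,r)$ for (w) and (m). -}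

module Defs where

open import Data.Nat using (ℕ; zero; suc; _+_; _*_; _⊔_; _≟_)
open import Data.Bool using (Bool; true; false; if_then_else_)
open import Data.List using (List; []; _∷_; map; length; filter)
open import Data.List.Relation.Unary.All using (All)
open import Data.List.Relation.Unary.Unique.Propositional using (Unique)
open import Data.List.Membership.Propositional using (_∈_)
open import Data.List.Membership.DecPropositional _≟_ using (_∈?_)
open import Data.Maybe using (Maybe; just; nothing)
open import Data.Product using (_×_; _,_; proj₁; proj₂)
open import Data.Sum using (_⊎_)
open import Relation.Nullary using (¬_; yes; no; does)
open import Relation.Binary.PropositionalEquality using (_≡_)

data Term : Set where
  var : ℕ → Term
  app : Term → Term → Term
  lam : ℕ → Term → Term

∣_∣ : Term → ℕ
∣ var x ∣ = 1
∣ app M N ∣ = ∣ M ∣ + ∣ N ∣ + 1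
∣ lam x M ∣ = ∣ M ∣ + 1

occursFree : ℕ → Term → Bool
occursFree x (var y) = does (x ≟ y)
occursFree x (app M N) = occursFree x M Data.Bool.∨ occursFree x N
occursFree x (lam y M) = if does (x ≟ y) then false else occursFree x M

bound : Term → List ℕ
bound (var y) = []
bound (app M N) = bound M Data.List.++ bound N
bound (lam y M) = y ∷ bound M

-- M[x/x1,...,x/xn] : replace free occurrences of the xi by x
-- (capture is excluded by the side condition of rule (m): x not bound in M)
rename : List ℕ → ℕ → Term → Term
rename xs x (var y) = if does (y ∈? xs) then var x else var y
rename xs x (app M N) = app (rename xs x M) (rename xs x N)
rename xs x (lam y M) = lam y (rename (filter (λ z → Relation.Nullary.¬? (z ≟ y)) xs) x M)

-- Types: linear types A and intersection types σ.
-- An intersection σ1 ∧ ... ∧ σn (n > 1) is  ⋀ σ1 σ2 [σ3,...,σn]  (flat, n-ary).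

mutual
  data Lin : Set where
    atom : ℕ → Lin
    _⇒_  : Ty → Lin → Lin

  data Ty : Set where
    lin : Lin → Ty
    ⋀   : Ty → Ty → List Ty → Ty

-- Equality of types modulo commutativity of ∧ (at every depth);
-- ∧ is neither idempotent nor associative.
mutual
  data _≈L_ : Lin → Lin → Set where
    atom : ∀ {a} → atom a ≈L atom a
    _⇒_  : ∀ {σ σ' A A'} → σ ≈ σ' → A ≈L A' → (σ ⇒ A) ≈L (σ' ⇒ A')

  data _≈_ : Ty → Ty → Set where
    lin : ∀ {A B} → A ≈L B → lin A ≈ lin B
    ⋀   : ∀ {σ₁ σ₂ σs τ₁ τ₂ τs} →
          (σ₁ ∷ σ₂ ∷ σs) ≈Perm (τ₁ ∷ τ₂ ∷ τs) → ⋀ σ₁ σ₂ σs ≈ ⋀ τ₁ τ₂ τs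

  data _≈Perm_ : List Ty → List Ty → Set where
    []    : [] ≈Perm []
    _∷_   : ∀ {σ τ σs τs} → σ ≈ τ → σs ≈Perm τs → (σ ∷ σs) ≈Perm (τ ∷ τs)
    swap  : ∀ {σ σ' τ τ' σs τs} → σ ≈ σ' → τ ≈ τ' → σs ≈Perm τs →
            (σ ∷ τ ∷ σs) ≈Perm (τ' ∷ σ' ∷ τs)
    trans : ∀ {σs τs ρs} → σs ≈Perm τs → τs ≈Perm ρs → σs ≈Perm ρs

-- Contexts: partial maps from variables to types (derivable contexts are finite).

Ctx : Set
Ctx = ℕ → Maybe Ty

∅ : Ctx
∅ _ = nothing

-- Γ, x:σ  (used only when x ∉ dom Γ)
_[_↦_] : Ctx → ℕ → Ty → Ctx
(Γ [ x ↦ σ ]) y = if does (y ≟ x) then just σ else Γ y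

_∖_ : Ctx → ℕ → Ctx
(Γ ∖ x) y = if does (y ≟ x) then nothing else Γ y

_∖*_ : Ctx → List ℕ → Ctx
Γ ∖* [] = Γ
Γ ∖* (x ∷ xs) = (Γ ∖ x) ∖* xs

_#_ : Ctx → Ctx → Set
Γ # Δ = ∀ x → Γ x ≡ nothing ⊎ Δ x ≡ nothing

-- Γ , Δ  (union, used for disjoint contexts)
_∪_ : Ctx → Ctx → Ctx
(Γ ∪ Δ) x with Γ x
... | just σ = just σ
... | nothing = Δ x

⋀ty : List Ty → Maybe Ty
⋀ty [] = nothing
⋀ty (σ ∷ []) = just σ
⋀ty (σ₁ ∷ σ₂ ∷ σs) = just (⋀ σ₁ σ₂ σs)

justs : List (Maybe Ty) → List Ty
justs [] = []
justs (just σ ∷ ms) = σ ∷ justs ms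
justs (nothing ∷ ms) = justs ms

⋀ctx : List Ctx → Ctx
⋀ctx Γs x = ⋀ty (justs (map (λ Γ → Γ x) Γs))

mutual
  data Der : Ctx → Term → Ty → Set where
    ax  : ∀ x A → Der (∅ [ x ↦ lin A ]) (var x) (lin A)
    w   : ∀ {Γ M σ} x A → Der Γ M σ → Γ x ≡ nothing → Der (Γ [ x ↦ lin A ]) M σ
    →I  : ∀ {Γ M A} x σ → Der Γ M (lin A) → Γ x ≡ just σ →
          Der (Γ ∖ x) (lam x M) (lin (σ ⇒ A))
    →E  : ∀ {Γ Δ M N σ σ' A} → Der Γ M (lin (σ ⇒ A)) → Der Δ N σ' →
          σ ≈ σ' → Γ # Δ → Der (Γ ∪ Δ) (app M N) (lin A)
    ∧n  : ∀ {Γ₁ Γ₂ M σ₁ σ₂ js} → Der Γ₁ M σ₁ → Der Γ₂ M σ₂ → Ders M js →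
          Der (⋀ctx (Γ₁ ∷ Γ₂ ∷ map proj₁ js)) M (⋀ σ₁ σ₂ (map proj₂ js))
    -- (m): premise Θ = Γ, x1:σ1, ..., xn:σn  (n > 1); conclusion Γ, x:σ1∧...∧σn
    m   : ∀ {Θ M τ} (p₁ p₂ : ℕ × Ty) (ps : List (ℕ × Ty)) (x : ℕ) →
          Der Θ M τ →
          Unique (map proj₁ (p₁ ∷ p₂ ∷ ps)) →
          All (λ p → Θ (proj₁ p) ≡ just (proj₂ p)) (p₁ ∷ p₂ ∷ ps) →
          (Θ ∖* map proj₁ (p₁ ∷ p₂ ∷ ps)) x ≡ nothing →
          ¬ (x ∈ bound M) →
          Der ((Θ ∖* map proj₁ (p₁ ∷ p₂ ∷ ps)) [ x ↦ ⋀ (proj₂ p₁) (proj₂ p₂) (map proj₂ ps) ])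
              (rename (map proj₁ (p₁ ∷ p₂ ∷ ps)) x M) τ

  data Ders (M : Term) : List (Ctx × Ty) → Set where
    []  : Ders M []
    _∷_ : ∀ {Γ σ js} → Der Γ M σ → Ders M js → Ders M ((Γ , σ) ∷ js)

countFree : List ℕ → Term → ℕ
countFree [] M = 0
countFree (y ∷ ys) M = (if occursFree y M then 1 else 0) + countFree ys M

mutual
  size : ∀ {Γ M σ} → Der Γ M σ → ℕ
  size (ax x A) = 1
  size (w x A Π _) = size Π + 1
  size (→I x σ Π _) = size Π + 1
  size (→E Π Σ _ _) = size Π + size Σ + 1
  size (∧n Π₁ Π₂ Πs) = size Π₁ + size Π₂ + sizes Πs + 1
  size (m p₁ p₂ ps x Π _ _ _ _) = size Π + 1

  sizes : ∀ {M js} → Ders M js → ℕ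
  sizes [] = 0
  sizes (Π ∷ Πs) = size Π + sizes Πs

mutual
  maxRank : ∀ {Γ M σ} → Der Γ M σ → ℕ
  maxRank (ax x A) = 0
  maxRank (w x A Π _) = maxRank Π
  maxRank (→I x σ Π _) = maxRank Π
  maxRank (→E Π Σ _ _) = maxRank Π ⊔ maxRank Σ
  maxRank (∧n Π₁ Π₂ Πs) = maxRank Π₁ ⊔ maxRank Π₂ ⊔ maxRanks Πs
  maxRank (m {M = M} p₁ p₂ ps x Π _ _ _ _) =
    countFree (map proj₁ (p₁ ∷ p₂ ∷ ps)) M ⊔ maxRank Π

  maxRanks : ∀ {M js} → Ders M js → ℕ
  maxRanks [] = 0
  maxRanks (Π ∷ Πs) = maxRank Π ⊔ maxRanks Πs

rk : ∀ {Γ M σ} → Der Γ M σ → ℕ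
rk Π = 1 ⊔ maxRank Π

mutual
  deg : ∀ {Γ M σ} → Der Γ M σ → ℕ
  deg (ax x A) = 0
  deg (w x A Π _) = deg Π
  deg (→I x σ Π _) = deg Π
  deg (→E Π Σ _ _) = deg Π ⊔ deg Σ
  deg (∧n Π₁ Π₂ Πs) = suc (deg Π₁ ⊔ deg Π₂ ⊔ degs Πs)
  deg (m p₁ p₂ ps x Π _ _ _ _) = deg Π

  degs : ∀ {M js} → Ders M js → ℕ
  degs [] = 0
  degs (Π ∷ Πs) = deg Π ⊔ degs Πs

mutual
  W : ∀ {Γ M σ} → Der Γ M σ → ℕ → ℕ
  W (ax x A) r = 1
  W (w x A Π _) r = W Π r
  W (→I x σ Π _) r = W Π r + 1
  W (→E Π Σ _ _) r = W Π r + W Σ r + 1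
  W (∧n Π₁ Π₂ Πs) r = r * (W Π₁ r ⊔ W Π₂ r ⊔ Ws Πs r)
  W (m p₁ p₂ ps x Π _ _ _ _) r = W Π r

  Ws : ∀ {M js} → Ders M js → ℕ → ℕ
  Ws [] r = 0
  Ws (Π ∷ Πs) r = W Π r ⊔ Ws Πs r

module Submission where

-- The weight at r = 1 counts every (Ax), (→I) and (→E) node on one branch per (∧n) and
-- ignores (w) and (m); since all premises of (∧n) type the same term and (m) only renames
-- variables, this traces exactly the syntax tree of M, so W(Π,1) = |M| ≤ |Π|.  For r ≥ 1
-- each (∧n) multiplies by r, and along any path there are at most d(Π) of them, giving
-- W(Π,r) ≤ r^d(Π)·|M|.  The rank of an (m) rule is bounded by |M| because the renamed
-- variables are distinct and each free one occupies at least one leaf of M.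

open import Defs hiding (trans)
open import Data.Bool using (Bool; true; false; if_then_else_; _∨_)
open import Data.List using ([]; _∷_; map)
open import Data.List.Relation.Unary.All using (All; []; _∷_)
open import Data.List.Relation.Unary.AllPairs using ([]; _∷_)
open import Data.List.Relation.Unary.Unique.Propositional using (Unique)
open import Data.Nat using (ℕ; suc; _+_; _*_; _^_; _⊔_; _≤_; _>_; _≟_; z≤n; s≤s; NonZero; >-nonZero)
open import Data.Nat.Properties
open import Algebra.Properties.CommutativeSemigroup +-commutativeSemigroup using (interchange)
open import Data.List.Membership.DecPropositional _≟_ using (_∈?_)
open import Data.Product using (_×_; _,_; proj₁)
open import Relation.Nullary using (yes; no; does)
open import Relation.Nullary.Decidable using (dec-true; dec-false)
open import Relation.Binary.PropositionalEquality
  using (_≡_; _≢_; refl; sym; trans; cong; cong₂; subst; module ≡-Reasoning)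

∣∣-rename : ∀ xs x M → ∣ rename xs x M ∣ ≡ ∣ M ∣
∣∣-rename xs x (var y) with does (y ∈? xs)
... | true  = refl
... | false = refl
∣∣-rename xs x (app M N) = cong₂ (λ a b → a + b + 1) (∣∣-rename xs x M) (∣∣-rename xs x N)
∣∣-rename xs x (lam y M) = cong (_+ 1) (∣∣-rename _ x M)

∣∣>0 : ∀ M → ∣ M ∣ > 0
∣∣>0 (var x)   = s≤s z≤n
∣∣>0 (app M N) = m≤n⇒m≤n+o 1 (m≤n⇒m≤n+o ∣ N ∣ (∣∣>0 M))
∣∣>0 (lam x M) = m≤n⇒m≤n+o 1 (∣∣>0 M)

bit : Bool → ℕ
bit b = if b then 1 else 0

bit-∨ : ∀ a b → bit (a ∨ b) ≤ bit a + bit b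
bit-∨ true  b = s≤s z≤n
bit-∨ false b = ≤-refl

countFree-app : ∀ xs M N → countFree xs (app M N) ≤ countFree xs M + countFree xs N
countFree-app []       M N = z≤n
countFree-app (z ∷ zs) M N = begin
  bit (occursFree z M ∨ occursFree z N) + countFree zs (app M N)
    ≤⟨ +-mono-≤ (bit-∨ (occursFree z M) (occursFree z N)) (countFree-app zs M N) ⟩
  (bit (occursFree z M) + bit (occursFree z N)) + (countFree zs M + countFree zs N)
    ≡⟨ interchange (bit (occursFree z M)) _ _ _ ⟩
  countFree (z ∷ zs) M + countFree (z ∷ zs) N ∎
  where open ≤-Reasoning

countFree-lam : ∀ xs y M → countFree xs (lam y M) ≤ countFree xs M
countFree-lam []       y M = z≤n
countFree-lam (z ∷ zs) y M with does (z ≟ y)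
... | true  = m≤n⇒m≤o+n (bit (occursFree z M)) (countFree-lam zs y M)
... | false = +-monoʳ-≤ (bit (occursFree z M)) (countFree-lam zs y M)

countFree-var-fresh : ∀ y zs → All (y ≢_) zs → countFree zs (var y) ≡ 0
countFree-var-fresh y []       []         = refl
countFree-var-fresh y (z ∷ zs) (y≢z ∷ ps) rewrite dec-false (z ≟ y) (λ z≡y → y≢z (sym z≡y)) =
  countFree-var-fresh y zs ps

countFree-var : ∀ y zs → Unique zs → countFree zs (var y) ≤ 1
countFree-var y []       _ = z≤n
countFree-var y (z ∷ zs) (z∉zs ∷ u) with z ≟ y
... | yes refl rewrite dec-true (z ≟ z) refl = ≤-reflexive (cong suc (countFree-var-fresh z zs z∉zs))
... | no z≢y   rewrite dec-false (z ≟ y) z≢y = countFree-var y zs u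

countFree≤∣∣ : ∀ xs M → Unique xs → countFree xs M ≤ ∣ M ∣
countFree≤∣∣ xs (var y)   u = countFree-var y xs u
countFree≤∣∣ xs (app M N) u = begin
  countFree xs (app M N)              ≤⟨ countFree-app xs M N ⟩
  countFree xs M + countFree xs N     ≤⟨ +-mono-≤ (countFree≤∣∣ xs M u) (countFree≤∣∣ xs N u) ⟩
  ∣ M ∣ + ∣ N ∣                       ≤⟨ m≤m+n _ 1 ⟩
  ∣ app M N ∣                         ∎
  where open ≤-Reasoning
countFree≤∣∣ xs (lam y M) u =
  m≤n⇒m≤n+o 1 (≤-trans (countFree-lam xs y M) (countFree≤∣∣ xs M u))

mutual
  W-1≡∣∣ : ∀ {Γ M σ} (Π : Der Γ M σ) → W Π 1 ≡ ∣ M ∣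
  W-1≡∣∣ (ax x A)       = refl
  W-1≡∣∣ (w x A Π _)    = W-1≡∣∣ Π
  W-1≡∣∣ (→I x σ Π _)   = cong (_+ 1) (W-1≡∣∣ Π)
  W-1≡∣∣ (→E Π Σ _ _)   = cong₂ (λ a b → a + b + 1) (W-1≡∣∣ Π) (W-1≡∣∣ Σ)
  W-1≡∣∣ {M = M} (∧n Π₁ Π₂ Πs) = begin
    1 * (W Π₁ 1 ⊔ W Π₂ 1 ⊔ Ws Πs 1)   ≡⟨ *-identityˡ _ ⟩
    W Π₁ 1 ⊔ W Π₂ 1 ⊔ Ws Πs 1         ≡⟨ cong₂ (λ a b → a ⊔ b ⊔ Ws Πs 1) (W-1≡∣∣ Π₁) (W-1≡∣∣ Π₂) ⟩
    ∣ M ∣ ⊔ ∣ M ∣ ⊔ Ws Πs 1           ≡⟨ cong (_⊔ Ws Πs 1) (⊔-idem ∣ M ∣) ⟩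
    ∣ M ∣ ⊔ Ws Πs 1                   ≡⟨ m≥n⇒m⊔n≡m (Ws-1≤∣∣ Πs) ⟩
    ∣ M ∣                             ∎
    where open ≡-Reasoning
  W-1≡∣∣ (m {M = M} p₁ p₂ ps x Π _ _ _ _) =
    trans (W-1≡∣∣ Π) (sym (∣∣-rename (map proj₁ (p₁ ∷ p₂ ∷ ps)) x M))

  Ws-1≤∣∣ : ∀ {M js} (Πs : Ders M js) → Ws Πs 1 ≤ ∣ M ∣
  Ws-1≤∣∣ []       = z≤n
  Ws-1≤∣∣ (Π ∷ Πs) = ⊔-lub (≤-reflexive (W-1≡∣∣ Π)) (Ws-1≤∣∣ Πs)

∣∣≤size : ∀ {Γ M σ} (Π : Der Γ M σ) → ∣ M ∣ ≤ size Π
∣∣≤size (ax x A)      = ≤-refl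
∣∣≤size (w x A Π _)   = m≤n⇒m≤n+o 1 (∣∣≤size Π)
∣∣≤size (→I x σ Π _)  = +-monoˡ-≤ 1 (∣∣≤size Π)
∣∣≤size (→E Π Σ _ _)  = +-monoˡ-≤ 1 (+-mono-≤ (∣∣≤size Π) (∣∣≤size Σ))
∣∣≤size (∧n Π₁ Π₂ Πs) = m≤n⇒m≤n+o 1 (m≤n⇒m≤n+o (sizes Πs) (m≤n⇒m≤n+o (size Π₂) (∣∣≤size Π₁)))
∣∣≤size (m {M = M} p₁ p₂ ps x Π _ _ _ _) rewrite ∣∣-rename (map proj₁ (p₁ ∷ p₂ ∷ ps)) x M =
  m≤n⇒m≤n+o 1 (∣∣≤size Π)

mutual
  maxRank≤∣∣ : ∀ {Γ M σ} (Π : Der Γ M σ) → maxRank Π ≤ ∣ M ∣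
  maxRank≤∣∣ (ax x A)      = z≤n
  maxRank≤∣∣ (w x A Π _)   = maxRank≤∣∣ Π
  maxRank≤∣∣ (→I x σ Π _)  = m≤n⇒m≤n+o 1 (maxRank≤∣∣ Π)
  maxRank≤∣∣ {M = app M N} (→E Π Σ _ _) = m≤n⇒m≤n+o 1
    (⊔-lub (m≤n⇒m≤n+o ∣ N ∣ (maxRank≤∣∣ Π)) (m≤n⇒m≤o+n ∣ M ∣ (maxRank≤∣∣ Σ)))
  maxRank≤∣∣ (∧n Π₁ Π₂ Πs) = ⊔-lub (⊔-lub (maxRank≤∣∣ Π₁) (maxRank≤∣∣ Π₂)) (maxRanks≤∣∣ Πs)
  maxRank≤∣∣ (m {M = M} p₁ p₂ ps x Π unique _ _ _)
    rewrite ∣∣-rename (map proj₁ (p₁ ∷ p₂ ∷ ps)) x M =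
    ⊔-lub (countFree≤∣∣ _ M unique) (maxRank≤∣∣ Π)

  maxRanks≤∣∣ : ∀ {M js} (Πs : Ders M js) → maxRanks Πs ≤ ∣ M ∣
  maxRanks≤∣∣ []       = z≤n
  maxRanks≤∣∣ (Π ∷ Πs) = ⊔-lub (maxRank≤∣∣ Π) (maxRanks≤∣∣ Πs)

rk≤∣∣ : ∀ {Γ M σ} (Π : Der Γ M σ) → rk Π ≤ ∣ M ∣
rk≤∣∣ {M = M} Π = ⊔-lub (∣∣>0 M) (maxRank≤∣∣ Π)

module _ (r : ℕ) .{{_ : NonZero r}} where

  raise-exponent : ∀ {a d e} n → a ≤ r ^ d * n → d ≤ e → a ≤ r ^ e * n
  raise-exponent n a≤ d≤e = ≤-trans a≤ (*-monoˡ-≤ n (^-monoʳ-≤ r d≤e))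

  succ-bound : ∀ d {a} n → a ≤ r ^ d * n → a + 1 ≤ r ^ d * (n + 1)
  succ-bound d {a} n a≤ = begin
    a + 1                  ≤⟨ +-mono-≤ a≤ (m^n>0 r d) ⟩
    r ^ d * n + r ^ d      ≡⟨ cong (r ^ d * n +_) (sym (*-identityʳ (r ^ d))) ⟩
    r ^ d * n + r ^ d * 1  ≡⟨ *-distribˡ-+ (r ^ d) n 1 ⟨
    r ^ d * (n + 1)        ∎
    where open ≤-Reasoning

  mutual
    W≤r^deg*∣∣ : ∀ {Γ M σ} (Π : Der Γ M σ) → W Π r ≤ r ^ deg Π * ∣ M ∣
    W≤r^deg*∣∣ (ax x A)     = ≤-reflexive (sym (*-identityʳ _))
    W≤r^deg*∣∣ (w x A Π _)  = W≤r^deg*∣∣ Π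
    W≤r^deg*∣∣ (→I x σ Π _) = succ-bound (deg Π) _ (W≤r^deg*∣∣ Π)
    W≤r^deg*∣∣ {M = app M N} (→E Π Σ _ _) = succ-bound D _ (begin
      W Π r + W Σ r                  ≤⟨ +-mono-≤ (raise-exponent ∣ M ∣ (W≤r^deg*∣∣ Π) (m≤m⊔n (deg Π) (deg Σ)))
                                                 (raise-exponent ∣ N ∣ (W≤r^deg*∣∣ Σ) (m≤n⊔m (deg Π) (deg Σ))) ⟩
      r ^ D * ∣ M ∣ + r ^ D * ∣ N ∣  ≡⟨ *-distribˡ-+ (r ^ D) ∣ M ∣ ∣ N ∣ ⟨
      r ^ D * (∣ M ∣ + ∣ N ∣)        ∎)
      where open ≤-Reasoning
            D = deg Π ⊔ deg Σ
    W≤r^deg*∣∣ {M = M} (∧n Π₁ Π₂ Πs) = begin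
      r * (W Π₁ r ⊔ W Π₂ r ⊔ Ws Πs r)  ≤⟨ *-monoʳ-≤ r (⊔-lub (⊔-lub
          (raise-exponent ∣ M ∣ (W≤r^deg*∣∣ Π₁) (m≤n⇒m≤n⊔o (degs Πs) (m≤m⊔n (deg Π₁) (deg Π₂))))
          (raise-exponent ∣ M ∣ (W≤r^deg*∣∣ Π₂) (m≤n⇒m≤n⊔o (degs Πs) (m≤n⊔m (deg Π₁) (deg Π₂)))))
          (raise-exponent ∣ M ∣ (Ws≤r^degs*∣∣ Πs) (m≤n⊔m (deg Π₁ ⊔ deg Π₂) (degs Πs)))) ⟩
      r * (r ^ D * ∣ M ∣)              ≡⟨ *-assoc r (r ^ D) ∣ M ∣ ⟨
      r ^ suc D * ∣ M ∣                ∎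
      where open ≤-Reasoning
            D = deg Π₁ ⊔ deg Π₂ ⊔ degs Πs
    W≤r^deg*∣∣ (m {M = M} p₁ p₂ ps x Π _ _ _ _)
      rewrite ∣∣-rename (map proj₁ (p₁ ∷ p₂ ∷ ps)) x M = W≤r^deg*∣∣ Π

    Ws≤r^degs*∣∣ : ∀ {M js} (Πs : Ders M js) → Ws Πs r ≤ r ^ degs Πs * ∣ M ∣
    Ws≤r^degs*∣∣ []       = z≤n
    Ws≤r^degs*∣∣ {M = M} (Π ∷ Πs) = ⊔-lub
      (raise-exponent ∣ M ∣ (W≤r^deg*∣∣ Π) (m≤m⊔n (deg Π) (degs Πs)))
      (raise-exponent ∣ M ∣ (Ws≤r^degs*∣∣ Πs) (m≤n⊔m (deg Π) (degs Πs)))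

mainTheorem6 : ∀ {Γ M σ} (Π : Der Γ M σ) →
    (rk Π ≤ ∣ M ∣ × ∣ M ∣ ≤ size Π)
    × (∀ (r : ℕ) → 1 ≤ r → W Π r ≤ r ^ deg Π * W Π 1)
    × W Π 1 ≡ ∣ M ∣
mainTheorem6 Π =
  (rk≤∣∣ Π , ∣∣≤size Π)
  , (λ r r>0 → subst (λ n → W Π r ≤ r ^ deg Π * n) (sym (W-1≡∣∣ Π))
                     (W≤r^deg*∣∣ r {{>-nonZero r>0}} Π))
  , W-1≡∣∣ Π
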